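{- Let $k,m,n,l\ge1$, let $\mu$ be a measure on $[k]$, and for $1\le i\le n$ let $a^i_1,\dots,a^i_m\subseteq[k]$. Then $$h_l\Big(\bigcup_{i=1}^n\{a^i_1,\dots,a^i_m\}\Big)=\frac{1}{(m!)^{n-1}}\sum_{\substack{\sigma\in\{\mathrm{id}\}\times S_m^{n-1}\\ 1\le t_1\le t_2\le\cdots\le t_l\le m\\ f:[l]\to P([n])\setminus\{\emptyset\}}}\ \prod_{j=1}^{l}(-1)^{|f(j)|+1}\,\mu\Big(\bigcap_{i\in f(j)}a^i_{\sigma_i(t_j)}\Big),$$ where $\sigma=(\sigma_1,\dots,\sigma_n)$ with $\sigma_1=\mathrm{id}$.
   Context: Work over $\mathbb{R}$. $[k]=\{1,\dots,k\}$; $\langle P[k]\rangle$ is the real vector space with basis the subsets of $[k]$, with union the bilinear extension of set union; $\langle P[k]\rangle^{\otimes m}$ has componentwise union and $S_m$ permutes tensor factors. $\mathrm{Sym}^m\langle P[k]\rangle=\langle P[k]\rangle^{\otimes m}/S_m$ (coinvariants), $\{a_1,\dots,a_m\}$ denotes the class of $a_1\otimes\cdots\otimes a_m$, union on it is $\bar u\cup\bar v=\frac{1}{m!}\sum_{\tau\in S_m}\overline{u\cup\tau v}$, and $\bigcup_{i=1}^n$ is the iterated union. A measure on $[k]$ is a map $\mu:P([k])\to\mathbb{R}$ with $\mu(a\cup b)=\mu(a)+\mu(b)$ for disjoint $a,b$. The complete homogeneous symmetric function is $h_l(x_1,\dots,x_m)=\sum_{1\le t_1\le\cdots\le t_l\le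 m}\prod_{j=1}^l x_{t_j}$, and $h_l:\mathrm{Sym}^m\langle P[k]\rangle\to\mathbb{R}$ is the linear map with $h_l(\{a_1,\dots,a_m\})=h_l(\mu(a_1),\dots,\mu(a_m))$. -}

module Defs where

open import Level using (Level)
open import Data.Nat as ℕ using (ℕ; zero; suc; _!)
open import Data.Bool using (Bool; true; false)
open import Data.Fin as Fin using (Fin; toℕ)
open import Data.Fin.Properties as FinP using (all?)
open import Data.Fin.Subset using (Subset; _∪_; _∩_; ⋂; Empty; ∣_∣)
open import Data.Fin.Subset.Properties using (_∈?_; nonempty?)
open import Data.Vec as Vec using (Vec; []; _∷_; lookup; tabulate; zipWith)
open import Data.Vec.Properties using (≡-dec)
open import Data.List as List using (List; []; _∷_; [_]; map; concatMap; filter; allFin; foldr; foldl)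
open import Data.Product using (_×_; _,_)
open import Relation.Binary.PropositionalEquality using (_≡_)
open import Relation.Nullary.Decidable using (_→-dec_)
open import Algebra.Bundles using (CommutativeRing)

vecsOver : ∀ {a} {A : Set a} → List A → (l : ℕ) → List (Vec A l)
vecsOver xs zero    = [ [] ]
vecsOver xs (suc l) = concatMap (λ x → map (x ∷_) (vecsOver xs l)) xs

allSubsets : (n : ℕ) → List (Subset n)
allSubsets n = vecsOver (false ∷ true ∷ []) n

Perm : ℕ → Set
Perm m = Vec (Fin m) m

IsInjective : ∀ {m} → Perm m → Set
IsInjective {m} v = ∀ (i j : Fin m) → lookup v i ≡ lookup v j → i ≡ j

perms : (m : ℕ) → List (Perm m)
perms m = filter (λ v → all? (λ i → all? (λ j → (lookup v i Fin.≟ lookup v j) →-dec (i Fin.≟ j))))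
                 (vecsOver (allFin m) m)

idPerm : ∀ m → Perm m
idPerm m = tabulate (λ i → i)

IsWeaklyIncreasing : ∀ {m l} → Vec (Fin m) l → Set
IsWeaklyIncreasing {m} {l} t = ∀ (i j : Fin l) → i Fin.≤ j → lookup t i Fin.≤ lookup t j

monoSeqs : (m l : ℕ) → List (Vec (Fin m) l)
monoSeqs m l = filter (λ t → all? (λ i → all? (λ j → (i Fin.≤? j) →-dec (lookup t i Fin.≤? lookup t j))))
                      (vecsOver (allFin m) l)

IsFirstId : ∀ {m n} → Vec (Perm m) n → Set
IsFirstId {m} {n} σ = ∀ (i : Fin n) → toℕ i ≡ 0 → lookup σ i ≡ idPerm m

permTuples : (m n : ℕ) → List (Vec (Perm m) n)
permTuples m n = filter (λ σ → all? (λ i → (toℕ i ℕ.≟ 0) →-dec (≡-dec Fin._≟_ (lookup σ i) (idPerm m))))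
                        (vecsOver (perms m) n)

nonemptyMaps : (n l : ℕ) → List (Vec (Subset n) l)
nonemptyMaps n l = vecsOver (filter nonempty? (allSubsets n)) l

-- Everything over a commutative ring R (ℝ is an instance)

module WithRing {c ℓ} (R : CommutativeRing c ℓ) where
  open CommutativeRing R

  sumR : List Carrier → Carrier
  sumR = foldr _+_ 0#

  prodR : List Carrier → Carrier
  prodR = foldr _*_ 1#

  natR : ℕ → Carrier
  natR zero    = 0#
  natR (suc n) = 1# + natR n

  powR : Carrier → ℕ → Carrier
  powR x zero    = 1#
  powR x (suc n) = x * powR x n

  sign : ℕ → Carrier
  sign e = powR (- 1#) e

  IsMeasure : ∀ {k} → (Subset k → Carrier) → Set ℓ
  IsMeasure {k} μ = ∀ (a b : Subset k) → Empty (a ∩ b) → μ (a ∪ b) ≈ μ a + μ b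

  hPoly : ∀ {m} (l : ℕ) → Vec Carrier m → Carrier
  hPoly {m} l x = sumR (map (λ t → prodR (List.map (λ j → lookup x (lookup t j)) (allFin l)))
                            (monoSeqs m l))

  -- elements of ⟨P[k]⟩^{⊗m}: formal R-linear combinations of basis
  -- tensors a_1 ⊗ … ⊗ a_m, represented as lists of (coefficient, basis tensor)
  Tensor : ℕ → ℕ → Set c
  Tensor k m = List (Carrier × Vec (Subset k) m)

  -- the pure tensor a_1 ⊗ … ⊗ a_m  (a representative of {a_1,…,a_m})
  pure : ∀ {k m} → Vec (Subset k) m → Tensor k m
  pure a = [ (1# , a) ]

  scaleT : ∀ {k m} → Carrier → Tensor k m → Tensor k m
  scaleT r = map (λ { (x , a) → (r * x , a) })

  _∪T_ : ∀ {k m} → Tensor k m → Tensor k m → Tensor k m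
  u ∪T v = concatMap (λ { (x , a) → map (λ { (y , b) → (x * y , zipWith _∪_ a b) }) v }) u

  actT : ∀ {k m} → Perm m → Tensor k m → Tensor k m
  actT τ = map (λ { (x , a) → (x , tabulate (λ i → lookup a (lookup τ i))) })

  -- union on Sym^m ⟨P[k]⟩ on representatives, given 1/m! = invm:
  --   ū ∪ v̄ = (1/m!) Σ_τ class(u ∪ τ v)
  symUnion : ∀ {k m} → Carrier → Tensor k m → Tensor k m → Tensor k m
  symUnion {m = m} invm u v = scaleT invm (concatMap (λ τ → u ∪T actT τ v) (perms m))

  unitT : ∀ {k m} → Tensor k m
  unitT {k} {m} = pure (Vec.replicate m (Vec.replicate k false))

  iterUnion : ∀ {k m} → Carrier → List (Tensor k m) → Tensor k m
  iterUnion invm []       = unitT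
  iterUnion invm (x ∷ xs) = foldl (symUnion invm) x xs

  -- the linear map h_l : Sym^m⟨P[k]⟩ → R evaluated on a representative;
  -- h_l({a_1,…,a_m}) = h_l(μ(a_1),…,μ(a_m))
  hSym : ∀ {k m} → (Subset k → Carrier) → ℕ → Tensor k m → Carrier
  hSym μ l T = sumR (map (λ { (x , a) → x * hPoly l (Vec.map μ a) }) T)

  -- the right-hand side of Theorem 4.9 (without the factor 1/(m!)^{n-1})
  rhsSum : ∀ {k m n} → (Subset k → Carrier) → (l : ℕ) → (Fin n → Vec (Subset k) m) → Carrier
  rhsSum {k} {m} {n} μ l a =
    sumR (map (λ σ → sumR (map (λ t → sumR (map (λ f →
      prodR (List.map (λ j →
        sign (suc ∣ lookup f j ∣) *
        μ (⋂ (List.map (λ i → lookup (a i) (lookup (lookup σ i) (lookup t j)))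
                       (filter (_∈? lookup f j) (allFin n)))))
        (allFin l)))
      (nonemptyMaps n l)))
      (monoSeqs m l)))
      (permTuples m n))

-- Each of the n − 1 unions averages over the m! ways of permuting the tensor
-- factors of the next term, so h_l of the iterated union is (1/m!)^(n−1) times
-- the sum, over σ = (id, σ₂, …, σₙ), of h_l at the basis tensor whose r-th
-- factor is ⋃ᵢ aⁱ_{σᵢ(r)}.  Inclusion–exclusion writes μ of each such factor as
-- Σ_{∅ ≠ S ⊆ [n]} (−1)^(|S|+1) μ(⋂_{i∈S} aⁱ_{σᵢ(r)}), and multiplying out the l
-- factors of each monomial of h_l turns the choice of one S per factor into the
-- maps f : [l] → P([n]) ∖ {∅}.  Inclusion–exclusion itself comes from the sieve
-- identity μ(∁ ⋃ᵢ bᵢ) = Σ_{S ⊆ [n]} (−1)^|S| μ(⋂_{i∈S} bᵢ), proved by induction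
-- on n using that W ↦ μ(b ∩ W) is again a measure.

{-# OPTIONS --safe #-}
module Submission where

open import Defs
open import Level using (Level; _⊔_)
open import Data.Nat using (ℕ; zero; suc; _≤_; _!; _∸_; s≤s)
open import Data.Bool using (true; false)
open import Data.Fin using (Fin; zero; suc)
import Data.Fin.Properties as FinP
open import Data.Fin.Subset using (Subset; _∪_; _∩_; ∁; ⋃; ⋂; ⊤; ⊥; ∣_∣; Empty)
open import Data.Fin.Subset.Properties as FSP using (_∈?_; nonempty?; x∈p∩q⁺; x∈p∩q⁻)
open import Data.Vec as Vec using (Vec; []; _∷_; lookup; tabulate; zipWith; replicate)
import Data.Vec.Properties as VP
open import Data.Vec.Relation.Binary.Pointwise.Inductive using (Pointwise-≡⇒≡; zipWith-assoc; zipWith-identityʳ)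
open import Data.List as List using (List; []; _∷_; map; concatMap; filter; allFin; foldl; _++_)
import Data.List.Properties as LP
import Data.List.Relation.Unary.All as All
open import Data.Product using (_,_; proj₁; proj₂)
open import Function using (_∘_; id)
open import Relation.Binary.PropositionalEquality as P using (_≡_; _≢_)
open import Relation.Nullary using (Dec; yes; no; ¬_; contradiction)
open import Relation.Nullary.Decidable using (¬?)
open import Relation.Unary using (Pred; Decidable)
open import Algebra.Bundles using (CommutativeRing)
import Algebra.Properties.CommutativeSemigroup as CommutativeSemigroupProperties
import Algebra.Properties.Group as GroupProperties
import Algebra.Properties.Ring as RingProperties
import Algebra.Lattice.Properties.BooleanAlgebra as BooleanAlgebraProperties

private variable
  ℓ₁ ℓ₂ : Level
  A : Set ℓ₁
  B : Set ℓ₂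

map-allFin-suc : ∀ {n} (f : Fin (suc n) → A) →
                 map f (allFin (suc n)) ≡ f zero ∷ map (f ∘ suc) (allFin n)
map-allFin-suc f = P.cong (f zero ∷_)
  (P.trans (LP.map-tabulate suc f) (P.sym (LP.map-tabulate id (f ∘ suc))))

filter-map : ∀ {p q} {P : Pred B p} {Q : Pred A q}
             (P? : Decidable P) (Q? : Decidable Q) (f : A → B) →
             (∀ {x} → P (f x) → Q x) → (∀ {x} → Q x → P (f x)) →
             ∀ xs → filter P? (map f xs) ≡ map f (filter Q? xs)
filter-map P? Q? f to from []       = P.refl
filter-map P? Q? f to from (x ∷ xs) with Q? x
... | yes q = P.trans (LP.filter-accept P? (from q)) (P.cong (f x ∷_) (filter-map P? Q? f to from xs))
... | no ¬q = P.trans (LP.filter-reject P? (¬q ∘ to)) (filter-map P? Q? f to from xs)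

elements : ∀ {n} → Subset n → List (Fin n)
elements {n} S = filter (_∈? S) (allFin n)

elements-⊥ : ∀ {n} → elements (⊥ {n}) ≡ []
elements-⊥ {n} = LP.filter-none (_∈? ⊥) (All.universal (λ _ → FSP.∉⊥) (allFin n))

map-elements-suc : ∀ {n} (b : Fin (suc n) → A) s (S : Subset n) →
                   map b (filter (_∈? (s ∷ S)) (List.tabulate suc)) ≡ map (b ∘ suc) (elements S)
map-elements-suc {n = n} b s S = begin
  map b (filter (_∈? (s ∷ S)) (List.tabulate suc))  ≡⟨ P.cong (map b ∘ filter (_∈? (s ∷ S))) (LP.map-tabulate id suc) ⟨
  map b (filter (_∈? (s ∷ S)) (map suc (allFin n)))
    ≡⟨ P.cong (map b) (filter-map (_∈? (s ∷ S)) (_∈? S) suc FSP.drop-there Vec.there (allFin n)) ⟩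
  map b (map suc (elements S))                       ≡⟨ LP.map-∘ (elements S) ⟨
  map (b ∘ suc) (elements S)                         ∎
  where open P.≡-Reasoning

map-elements-false : ∀ {n} (b : Fin (suc n) → A) (S : Subset n) →
                     map b (elements (false ∷ S)) ≡ map (b ∘ suc) (elements S)
map-elements-false b = map-elements-suc b false

map-elements-true : ∀ {n} (b : Fin (suc n) → A) (S : Subset n) →
                    map b (elements (true ∷ S)) ≡ b zero ∷ map (b ∘ suc) (elements S)
map-elements-true b S = P.cong (b zero ∷_) (map-elements-suc b true S)

module _ {k m : ℕ} where

  infixl 6 _∪ᵥ_
  _∪ᵥ_ : Vec (Subset k) m → Vec (Subset k) m → Vec (Subset k) m
  _∪ᵥ_ = zipWith _∪_

  ∪ᵥ-identityʳ : ∀ a → a ∪ᵥ replicate m ⊥ ≡ a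
  ∪ᵥ-identityʳ a = Pointwise-≡⇒≡ (zipWith-identityʳ FSP.∪-identityʳ a)

  ∪ᵥ-assoc : ∀ a b c → (a ∪ᵥ b) ∪ᵥ c ≡ a ∪ᵥ (b ∪ᵥ c)
  ∪ᵥ-assoc a b c = Pointwise-≡⇒≡ (zipWith-assoc FSP.∪-assoc a b c)

  permute : Perm m → Vec (Subset k) m → Vec (Subset k) m
  permute τ a = tabulate (λ r → lookup a (lookup τ r))

  permute-id : ∀ a → permute (idPerm m) a ≡ a
  permute-id a = P.trans (VP.tabulate-cong (λ r → P.cong (lookup a) (VP.lookup∘tabulate id r)))
                         (VP.tabulate∘lookup a)

  unionAlong : ∀ {n} → Vec (Perm m) n → (Fin n → Vec (Subset k) m) → Vec (Subset k) m
  unionAlong []      a = replicate m ⊥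
  unionAlong (τ ∷ σ) a = permute τ (a zero) ∪ᵥ unionAlong σ (a ∘ suc)

  unionAlong-id : ∀ {n} (σ : Vec (Perm m) n) a → a zero ∪ᵥ unionAlong σ (a ∘ suc) ≡ unionAlong (idPerm m ∷ σ) a
  unionAlong-id σ a = P.cong (_∪ᵥ unionAlong σ (a ∘ suc)) (P.sym (permute-id (a zero)))

  lookup-unionAlong : ∀ {n} (σ : Vec (Perm m) n) a r →
                      lookup (unionAlong σ a) r ≡ ⋃ (List.tabulate (λ i → lookup (a i) (lookup (lookup σ i) r)))
  lookup-unionAlong []      a r = VP.lookup-replicate r ⊥
  lookup-unionAlong (τ ∷ σ) a r = P.trans (VP.lookup-zipWith _∪_ r (permute τ (a zero)) (unionAlong σ (a ∘ suc)))
    (P.cong₂ _∪_ (VP.lookup∘tabulate (lookup (a zero) ∘ lookup τ) r) (lookup-unionAlong σ (a ∘ suc) r))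

idPerm-injective : ∀ {m} → IsInjective (idPerm m)
idPerm-injective i j eq = P.trans (P.sym (VP.lookup∘tabulate id i)) (P.trans eq (VP.lookup∘tabulate id j))

module OverRing {c ℓ} (R : CommutativeRing c ℓ) where
  open CommutativeRing R hiding (zero)
  open WithRing R
  open RingProperties ring using (-1*x≈-x)
  open GroupProperties +-group using (x≈z//y; ∙-cancelˡ; ⁻¹-involutive)
  open CommutativeSemigroupProperties +-commutativeSemigroup using (interchange)
  open CommutativeSemigroupProperties *-commutativeSemigroup using (x∙yz≈yx∙z)
  open import Relation.Binary.Reasoning.Setoid setoid

  ∑ : List A → (A → Carrier) → Carrier
  ∑ xs f = sumR (map f xs)

  ∏ : List A → (A → Carrier) → Carrier
  ∏ xs f = prodR (map f xs)

  infix 5 ∑ ∏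
  syntax ∑ xs (λ x → e) = ∑[ x ← xs ] e
  syntax ∏ xs (λ x → e) = ∏[ x ← xs ] e

  ∑-cong : ∀ xs {f g : A → Carrier} → (∀ x → f x ≈ g x) → ∑ xs f ≈ ∑ xs g
  ∑-cong []       f≈g = refl
  ∑-cong (x ∷ xs) f≈g = +-cong (f≈g x) (∑-cong xs f≈g)

  ∏-cong : ∀ xs {f g : A → Carrier} → (∀ x → f x ≈ g x) → ∏ xs f ≈ ∏ xs g
  ∏-cong []       f≈g = refl
  ∏-cong (x ∷ xs) f≈g = *-cong (f≈g x) (∏-cong xs f≈g)

  ∑-vanishing : ∀ xs {f : A → Carrier} → (∀ x → f x ≈ 0#) → ∑ xs f ≈ 0#
  ∑-vanishing []       f≈0 = refl
  ∑-vanishing (x ∷ xs) f≈0 = trans (+-cong (f≈0 x) (∑-vanishing xs f≈0)) (+-identityˡ 0#)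

  ∑-++ : ∀ xs ys (f : A → Carrier) → ∑ (xs ++ ys) f ≈ ∑ xs f + ∑ ys f
  ∑-++ []       ys f = sym (+-identityˡ _)
  ∑-++ (x ∷ xs) ys f = trans (+-congˡ (∑-++ xs ys f)) (sym (+-assoc _ _ _))

  ∑-+ : ∀ xs (f g : A → Carrier) → ∑[ x ← xs ] (f x + g x) ≈ ∑ xs f + ∑ xs g
  ∑-+ []       f g = sym (+-identityˡ 0#)
  ∑-+ (x ∷ xs) f g = trans (+-congˡ (∑-+ xs f g)) (interchange _ _ _ _)

  *-distribˡ-∑ : ∀ r xs (f : A → Carrier) → r * ∑ xs f ≈ ∑[ x ← xs ] r * f x
  *-distribˡ-∑ r []       f = zeroʳ r
  *-distribˡ-∑ r (x ∷ xs) f = trans (distribˡ r _ _) (+-congˡ (*-distribˡ-∑ r xs f))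

  *-distribʳ-∑ : ∀ r xs (f : A → Carrier) → ∑ xs f * r ≈ ∑[ x ← xs ] f x * r
  *-distribʳ-∑ r []       f = zeroˡ r
  *-distribʳ-∑ r (x ∷ xs) f = trans (distribʳ r _ _) (+-congˡ (*-distribʳ-∑ r xs f))

  -‿distrib-∑ : ∀ xs (f : A → Carrier) → - ∑ xs f ≈ ∑[ x ← xs ] - f x
  -‿distrib-∑ xs f = begin
    - ∑ xs f                 ≈⟨ -1*x≈-x _ ⟨
    - 1# * ∑ xs f            ≈⟨ *-distribˡ-∑ (- 1#) xs f ⟩
    ∑[ x ← xs ] - 1# * f x   ≈⟨ ∑-cong xs (λ x → -1*x≈-x (f x)) ⟩
    ∑[ x ← xs ] - f x        ∎

  ∑-map : ∀ xs (g : A → B) (f : B → Carrier) → ∑ (map g xs) f ≡ ∑ xs (f ∘ g)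
  ∑-map xs g f = P.cong sumR (P.sym (LP.map-∘ xs))

  ∑-concatMap : ∀ xs (F : A → List B) (f : B → Carrier) →
                ∑ (concatMap F xs) f ≈ ∑[ x ← xs ] ∑ (F x) f
  ∑-concatMap []       F f = refl
  ∑-concatMap (x ∷ xs) F f = trans (∑-++ (F x) (concatMap F xs) f) (+-congˡ (∑-concatMap xs F f))

  ∑-comm : ∀ xs (ys : List B) (f : A → B → Carrier) →
           ∑[ x ← xs ] ∑[ y ← ys ] f x y ≈ ∑[ y ← ys ] ∑[ x ← xs ] f x y
  ∑-comm []       ys f = sym (∑-vanishing ys (λ _ → refl))
  ∑-comm (x ∷ xs) ys f = trans (+-congˡ (∑-comm xs ys f)) (sym (∑-+ ys (f x) _))

  ∑-vecsOver-suc : ∀ xs l (f : Vec A (suc l) → Carrier) →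
                   ∑ (vecsOver xs (suc l)) f ≈ ∑[ x ← xs ] ∑[ v ← vecsOver xs l ] f (x ∷ v)
  ∑-vecsOver-suc xs l f =
    trans (∑-concatMap xs _ f) (∑-cong xs (λ x → reflexive (∑-map (vecsOver xs l) (x ∷_) f)))

  ∑-allFin-suc : ∀ {n} (f : Fin (suc n) → Carrier) → ∑ (allFin (suc n)) f ≡ f zero + ∑ (allFin n) (f ∘ suc)
  ∑-allFin-suc f = P.cong sumR (map-allFin-suc f)

  ∏-allFin-suc : ∀ {n} (f : Fin (suc n) → Carrier) → ∏ (allFin (suc n)) f ≡ f zero * ∏ (allFin n) (f ∘ suc)
  ∏-allFin-suc f = P.cong prodR (map-allFin-suc f)

  ∏-∑-distrib : ∀ (xs : List A) l (F : Fin l → A → Carrier) →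
                ∏[ j ← allFin l ] ∑ xs (F j) ≈ ∑[ f ← vecsOver xs l ] ∏[ j ← allFin l ] F j (lookup f j)
  ∏-∑-distrib xs zero    F = sym (+-identityʳ 1#)
  ∏-∑-distrib xs (suc l) F = begin
    ∏[ j ← allFin (suc l) ] ∑ xs (F j)                  ≡⟨ ∏-allFin-suc (λ j → ∑ xs (F j)) ⟩
    ∑ xs (F zero) * (∏[ j ← allFin l ] ∑ xs (F (suc j))) ≈⟨ *-congˡ (∏-∑-distrib xs l (F ∘ suc)) ⟩
    ∑ xs (F zero) * ∑ V Π                               ≈⟨ *-distribʳ-∑ _ xs _ ⟩
    ∑[ x ← xs ] F zero x * ∑ V Π                        ≈⟨ ∑-cong xs (λ x → *-distribˡ-∑ _ V Π) ⟩
    ∑[ x ← xs ] ∑[ f ← V ] F zero x * Π f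
      ≈⟨ ∑-cong xs (λ x → ∑-cong V (λ f → reflexive (P.sym (∏-allFin-suc (λ j → F j (lookup (x ∷ f) j)))))) ⟩
    ∑[ x ← xs ] ∑[ f ← V ] ∏[ j ← allFin (suc l) ] F j (lookup (x ∷ f) j)
                                                        ≈⟨ ∑-vecsOver-suc xs l _ ⟨
    ∑[ f ← vecsOver xs (suc l) ] ∏[ j ← allFin (suc l) ] F j (lookup f j) ∎
    where
    V = vecsOver xs l
    Π = λ f → ∏[ j ← allFin l ] F (suc j) (lookup f j)

  infix 5 _if_
  _if_ : ∀ {p} {P : Set p} → Carrier → Dec P → Carrier
  x if yes _ = x
  x if no  _ = 0#

  if-yes : ∀ {p} {P : Set p} (d : Dec P) {x} → P → x if d ≈ x
  if-yes (yes _)  _ = refl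
  if-yes (no ¬p)  p = contradiction p ¬p

  if-no : ∀ {p} {P : Set p} (d : Dec P) {x} → ¬ P → x if d ≈ 0#
  if-no (yes p) ¬p = contradiction p ¬p
  if-no (no _)  _  = refl

  if-vanishing : ∀ {p} {P : Set p} (d : Dec P) {x} → x ≈ 0# → x if d ≈ 0#
  if-vanishing (yes _) x≈0 = x≈0
  if-vanishing (no _)  _   = refl

  if-split : ∀ {p} {P : Set p} (d : Dec P) x → x ≈ (x if ¬? d) + (x if d)
  if-split (yes _) x = sym (+-identityˡ x)
  if-split (no _)  x = sym (+-identityʳ x)

  ∑-filter : ∀ {p} {P : Pred A p} (P? : Decidable P) xs (f : A → Carrier) →
             ∑ (filter P? xs) f ≈ ∑[ x ← xs ] (f x if P? x)
  ∑-filter P? []       f = refl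
  ∑-filter P? (x ∷ xs) f with P? x
  ... | yes _ = +-congˡ (∑-filter P? xs f)
  ... | no  _ = trans (∑-filter P? xs f) (sym (+-identityˡ _))

  -- w occurs exactly once in xs, as far as sums over xs can tell.
  record Picks {a} {A : Set a} (xs : List A) (w : A) : Set (a ⊔ c ⊔ ℓ) where
    field pick : ∀ f → (∀ x → x ≢ w → f x ≈ 0#) → ∑ xs f ≈ f w
  open Picks

  allFin-picks : ∀ {n} (w : Fin n) → Picks (allFin n) w
  allFin-picks {suc n} zero .pick f vanish = begin
    ∑ (allFin (suc n)) f             ≡⟨ ∑-allFin-suc f ⟩
    f zero + ∑ (allFin n) (f ∘ suc)  ≈⟨ +-congˡ (∑-vanishing (allFin n) (λ i → vanish (suc i) λ ())) ⟩
    f zero + 0#                      ≈⟨ +-identityʳ _ ⟩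
    f zero                           ∎
  allFin-picks {suc n} (suc w) .pick f vanish = begin
    ∑ (allFin (suc n)) f             ≡⟨ ∑-allFin-suc f ⟩
    f zero + ∑ (allFin n) (f ∘ suc)  ≈⟨ +-cong (vanish zero λ ()) (allFin-picks w .pick (f ∘ suc) vanish∘suc) ⟩
    0# + f (suc w)                   ≈⟨ +-identityˡ _ ⟩
    f (suc w)                        ∎
    where
    vanish∘suc : ∀ i → i ≢ w → f (suc i) ≈ 0#
    vanish∘suc i i≢w = vanish (suc i) (i≢w ∘ FinP.suc-injective)

  bool-picks : ∀ x → Picks (false ∷ true ∷ []) x
  bool-picks false .pick f vanish = trans (+-congˡ (trans (+-identityʳ _) (vanish true λ ()))) (+-identityʳ _)
  bool-picks true  .pick f vanish = trans (+-cong (vanish false λ ()) (+-identityʳ _)) (+-identityˡ _)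

  vecsOver-picks : ∀ {xs : List A} → (∀ x → Picks xs x) → ∀ {l} (w : Vec A l) → Picks (vecsOver xs l) w
  vecsOver-picks picks [] .pick f vanish = +-identityʳ (f [])
  vecsOver-picks {xs = xs} picks {suc l} (w ∷ ws) .pick f vanish = begin
    ∑ (vecsOver xs (suc l)) f                     ≈⟨ ∑-vecsOver-suc xs l f ⟩
    ∑[ x ← xs ] ∑[ v ← vecsOver xs l ] f (x ∷ v)  ≈⟨ picks w .pick _ vanish-head ⟩
    ∑[ v ← vecsOver xs l ] f (w ∷ v)              ≈⟨ vecsOver-picks picks ws .pick (f ∘ (w ∷_)) vanish-tail ⟩
    f (w ∷ ws)                                    ∎
    where
    vanish-head : ∀ x → x ≢ w → ∑[ v ← vecsOver xs l ] f (x ∷ v) ≈ 0#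
    vanish-head x x≢w = ∑-vanishing (vecsOver xs l) (λ v → vanish (x ∷ v) (x≢w ∘ VP.∷-injectiveˡ))
    vanish-tail : ∀ v → v ≢ ws → f (w ∷ v) ≈ 0#
    vanish-tail v v≢ws = vanish (w ∷ v) (v≢ws ∘ VP.∷-injectiveʳ)

  filter-picks : ∀ {p} {P : Pred A p} (P? : Decidable P) {xs w} → P w → Picks xs w → Picks (filter P? xs) w
  filter-picks P? {xs} {w} Pw picks .pick f vanish = begin
    ∑ (filter P? xs) f         ≈⟨ ∑-filter P? xs f ⟩
    ∑[ x ← xs ] (f x if P? x)  ≈⟨ picks .pick _ (λ x x≢w → if-vanishing (P? x) (vanish x x≢w)) ⟩
    f w if P? w                ≈⟨ if-yes (P? w) Pw ⟩
    f w                        ∎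

  ∑-filter-but-one : ∀ {p} {P : Pred A p} (P? : Decidable P) {xs w} → Picks xs w →
                     ¬ P w → (∀ {x} → ¬ P x → x ≡ w) →
                     (f : A → Carrier) → ∑ xs f ≈ f w + ∑ (filter P? xs) f
  ∑-filter-but-one P? {xs} {w} picks ¬Pw only-w f = begin
    ∑ xs f                                                   ≈⟨ ∑-cong xs (λ x → if-split (P? x) (f x)) ⟩
    ∑[ x ← xs ] ((f x if ¬? (P? x)) + (f x if P? x))         ≈⟨ ∑-+ xs _ _ ⟩
    (∑[ x ← xs ] (f x if ¬? (P? x))) + (∑[ x ← xs ] (f x if P? x))
                                                             ≈⟨ +-cong (picks .pick _ (λ x x≢w → if-no (¬? (P? x)) (x≢w ∘ only-w)))
                                                                       (sym (∑-filter P? xs f)) ⟩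
    (f w if ¬? (P? w)) + ∑ (filter P? xs) f                  ≈⟨ +-congʳ (if-yes (¬? (P? w)) ¬Pw) ⟩
    f w + ∑ (filter P? xs) f                                 ∎

  ∑-filter-head : ∀ {l p} {P : Pred (Vec A (suc l)) p} (P? : Decidable P) {xs : List A} {w : A} →
                  (∀ {x v} → P (x ∷ v) → x ≡ w) → (∀ v → P (w ∷ v)) → Picks xs w →
                  (G : Vec A (suc l) → Carrier) →
                  ∑ (filter P? (vecsOver xs (suc l))) G ≈ ∑[ v ← vecsOver xs l ] G (w ∷ v)
  ∑-filter-head {l = l} P? {xs} {w} head≡w P-w∷ picks G = begin
    ∑ (filter P? (vecsOver xs (suc l))) G                     ≈⟨ ∑-filter P? (vecsOver xs (suc l)) G ⟩
    ∑[ v ← vecsOver xs (suc l) ] (G v if P? v)                ≈⟨ ∑-vecsOver-suc xs l _ ⟩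
    ∑[ x ← xs ] ∑[ v ← V ] (G (x ∷ v) if P? (x ∷ v))
      ≈⟨ picks .pick _ (λ x x≢w → ∑-vanishing V (λ v → if-no (P? (x ∷ v)) (x≢w ∘ head≡w))) ⟩
    ∑[ v ← V ] (G (w ∷ v) if P? (w ∷ v))                      ≈⟨ ∑-cong V (λ v → if-yes (P? (w ∷ v)) (P-w∷ v)) ⟩
    ∑[ v ← V ] G (w ∷ v)                                      ∎
    where V = vecsOver xs l

  perms-picks-id : ∀ {m} → Picks (perms m) (idPerm m)
  perms-picks-id = filter-picks _ idPerm-injective (vecsOver-picks allFin-picks _)

  ∑-permTuples : ∀ {m n} (G : Vec (Perm m) (suc n) → Carrier) →
                 ∑ (permTuples m (suc n)) G ≈ ∑[ σ ← vecsOver (perms m) n ] G (idPerm m ∷ σ)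
  ∑-permTuples G = ∑-filter-head _ (λ first-id → first-id zero P.refl) (λ { σ zero _ → P.refl ; σ (suc i) () })
                                 perms-picks-id G

  sign-suc : ∀ e x → sign (suc e) * x ≈ - (sign e * x)
  sign-suc e x = trans (*-assoc _ _ _) (-1*x≈-x _)

  module _ {k} {μ : Subset k → Carrier} (μ-measure : IsMeasure μ) where

    measure-split : ∀ Z X → μ X ≈ μ (∁ Z ∩ X) + μ (Z ∩ X)
    measure-split Z X = begin
      μ X                        ≡⟨ P.cong μ X≡ ⟨
      μ ((∁ Z ∩ X) ∪ (Z ∩ X))    ≈⟨ μ-measure _ _ disjoint ⟩
      μ (∁ Z ∩ X) + μ (Z ∩ X)    ∎
      where
      X≡ : (∁ Z ∩ X) ∪ (Z ∩ X) ≡ X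
      X≡ = P.trans (P.sym (FSP.∩-distribʳ-∪ X (∁ Z) Z))
                   (P.trans (P.cong (_∩ X) (FSP.∪-inverseˡ Z)) (FSP.∩-identityˡ X))
      disjoint : Empty ((∁ Z ∩ X) ∩ (Z ∩ X))
      disjoint (i , i∈) with x∈p∩q⁻ _ _ i∈
      ... | i∈∁Z∩X , i∈Z∩X = FSP.x∈∁p⇒x∉p (proj₁ (x∈p∩q⁻ _ _ i∈∁Z∩X)) (proj₁ (x∈p∩q⁻ _ _ i∈Z∩X))

    measure-complement : ∀ Z X → μ (∁ Z ∩ X) ≈ μ X + - μ (Z ∩ X)
    measure-complement Z X = x≈z//y _ _ _ (sym (measure-split Z X))

    restrict-measure : ∀ W → IsMeasure (λ X → μ (W ∩ X))
    restrict-measure W X Y X∩Y-empty = begin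
      μ (W ∩ (X ∪ Y))          ≡⟨ P.cong μ (FSP.∩-distribˡ-∪ W X Y) ⟩
      μ ((W ∩ X) ∪ (W ∩ Y))    ≈⟨ μ-measure _ _ disjoint ⟩
      μ (W ∩ X) + μ (W ∩ Y)    ∎
      where
      disjoint : Empty ((W ∩ X) ∩ (W ∩ Y))
      disjoint (i , i∈) with x∈p∩q⁻ _ _ i∈
      ... | i∈W∩X , i∈W∩Y = X∩Y-empty (i , x∈p∩q⁺ (proj₂ (x∈p∩q⁻ W X i∈W∩X) , proj₂ (x∈p∩q⁻ W Y i∈W∩Y)))

  ∑-allSubsets-suc : ∀ n (g : Subset (suc n) → Carrier) →
                     ∑ (allSubsets (suc n)) g ≈ (∑[ S ← allSubsets n ] g (false ∷ S)) + (∑[ S ← allSubsets n ] g (true ∷ S))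
  ∑-allSubsets-suc n g = trans (∑-vecsOver-suc (false ∷ true ∷ []) n g) (+-congˡ (+-identityʳ _))

  sieve : ∀ {k} {μ : Subset k → Carrier} → IsMeasure μ → ∀ {n} (b : Fin n → Subset k) →
          μ (∁ (⋃ (List.tabulate b))) ≈ ∑[ S ← allSubsets n ] sign ∣ S ∣ * μ (⋂ (map b (elements S)))
  sieve {k} {μ} μ-measure {zero} b = begin
    μ (∁ ⊥)        ≡⟨ P.cong μ ¬⊥≈⊤ ⟩
    μ ⊤            ≈⟨ *-identityˡ _ ⟨
    1# * μ ⊤       ≈⟨ +-identityʳ _ ⟨
    1# * μ ⊤ + 0#  ∎
    where open BooleanAlgebraProperties (FSP.∪-∩-booleanAlgebra k) using (¬⊥≈⊤)
  sieve {k} {μ} μ-measure {suc n} b = begin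
    μ (∁ (b zero ∪ U))                                           ≡⟨ P.cong μ (deMorgan₂ (b zero) U) ⟩
    μ (∁ (b zero) ∩ ∁ U)                                         ≈⟨ measure-complement μ-measure (b zero) (∁ U) ⟩
    μ (∁ U) + - μ (b zero ∩ ∁ U)                                 ≈⟨ +-cong without-b₀ with-b₀ ⟩
    (∑[ S ← Sₙ ] t (false ∷ S)) + (∑[ S ← Sₙ ] t (true ∷ S))     ≈⟨ ∑-allSubsets-suc n t ⟨
    ∑[ S ← allSubsets (suc n) ] t S                              ∎
    where
    open BooleanAlgebraProperties (FSP.∪-∩-booleanAlgebra k) using (deMorgan₂)
    U = ⋃ (List.tabulate (b ∘ suc))
    Sₙ = allSubsets n
    I : Subset n → Subset k
    I S = ⋂ (map (b ∘ suc) (elements S))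
    t : Subset (suc n) → Carrier
    t S = sign ∣ S ∣ * μ (⋂ (map b (elements S)))
    without-b₀ : μ (∁ U) ≈ ∑[ S ← Sₙ ] t (false ∷ S)
    without-b₀ = trans (sieve μ-measure (b ∘ suc))
      (∑-cong Sₙ (λ S → reflexive (P.cong (λ L → sign ∣ S ∣ * μ (⋂ L)) (P.sym (map-elements-false b S)))))
    with-b₀ : - μ (b zero ∩ ∁ U) ≈ ∑[ S ← Sₙ ] t (true ∷ S)
    with-b₀ = begin
      - μ (b zero ∩ ∁ U)                                ≈⟨ -‿cong (sieve (restrict-measure μ-measure (b zero)) (b ∘ suc)) ⟩
      - (∑[ S ← Sₙ ] sign ∣ S ∣ * μ (b zero ∩ I S))     ≈⟨ -‿distrib-∑ Sₙ _ ⟩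
      ∑[ S ← Sₙ ] - (sign ∣ S ∣ * μ (b zero ∩ I S))     ≈⟨ ∑-cong Sₙ (λ S → sign-suc ∣ S ∣ _) ⟨
      ∑[ S ← Sₙ ] sign (suc ∣ S ∣) * μ (b zero ∩ I S)
        ≈⟨ ∑-cong Sₙ (λ S → reflexive (P.cong (λ L → sign (suc ∣ S ∣) * μ (⋂ L)) (P.sym (map-elements-true b S)))) ⟩
      ∑[ S ← Sₙ ] t (true ∷ S)                          ∎

  inclusion-exclusion : ∀ {k} {μ : Subset k → Carrier} → IsMeasure μ → ∀ {n} (b : Fin n → Subset k) →
                        μ (⋃ (List.tabulate b)) ≈
                        ∑[ S ← filter nonempty? (allSubsets n) ] sign (suc ∣ S ∣) * μ (⋂ (map b (elements S)))
  inclusion-exclusion {k} {μ} μ-measure {n} b = begin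
    μ U                                 ≈⟨ ⁻¹-involutive _ ⟨
    - - μ U                             ≈⟨ -‿cong -μU≈N ⟩
    - ∑ NE t                            ≈⟨ -‿distrib-∑ NE t ⟩
    ∑[ S ← NE ] - t S                   ≈⟨ ∑-cong NE (λ S → sign-suc ∣ S ∣ _) ⟨
    ∑[ S ← NE ] sign (suc ∣ S ∣) * μ (⋂ (map b (elements S))) ∎
    where
    U = ⋃ (List.tabulate b)
    NE = filter nonempty? (allSubsets n)
    t : Subset n → Carrier
    t S = sign ∣ S ∣ * μ (⋂ (map b (elements S)))
    t⊥≈μ⊤ : t ⊥ ≈ μ ⊤
    t⊥≈μ⊤ = trans (*-cong (reflexive (P.cong sign (FSP.∣⊥∣≡0 n)))
                          (reflexive (P.cong (μ ∘ ⋂ ∘ map b) elements-⊥)))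
                  (*-identityˡ _)
    μ∁U : μ (∁ U) ≈ μ ⊤ + - μ U
    μ∁U = begin
      μ (∁ U)              ≡⟨ P.cong μ (FSP.∩-identityʳ (∁ U)) ⟨
      μ (∁ U ∩ ⊤)          ≈⟨ measure-complement μ-measure U ⊤ ⟩
      μ ⊤ + - μ (U ∩ ⊤)    ≡⟨ P.cong (λ X → μ ⊤ + - μ X) (FSP.∩-identityʳ U) ⟩
      μ ⊤ + - μ U          ∎
    -μU≈N : - μ U ≈ ∑ NE t
    -μU≈N = ∙-cancelˡ (μ ⊤) _ _ (begin
      μ ⊤ + - μ U                ≈⟨ μ∁U ⟨
      μ (∁ U)                    ≈⟨ sieve μ-measure b ⟩
      ∑ (allSubsets n) t         ≈⟨ ∑-filter-but-one nonempty? (vecsOver-picks bool-picks ⊥)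
                                                       (λ { (_ , i∈⊥) → FSP.∉⊥ i∈⊥ }) FSP.Empty-unique t ⟩
      t ⊥ + ∑ NE t               ≈⟨ +-congʳ t⊥≈μ⊤ ⟩
      μ ⊤ + ∑ NE t               ∎)

  module _ {k m : ℕ} where

    extend : (Vec (Subset k) m → Carrier) → Tensor k m → Carrier
    extend φ T = ∑[ t ← T ] proj₁ t * φ (proj₂ t)

    extend-cong : ∀ T {φ ψ} → (∀ a → φ a ≈ ψ a) → extend φ T ≈ extend ψ T
    extend-cong T φ≈ψ = ∑-cong T (λ t → *-congˡ (φ≈ψ (proj₂ t)))

    extend-pure : ∀ φ a → extend φ (pure a) ≈ φ a
    extend-pure φ a = trans (+-identityʳ _) (*-identityˡ _)

    extend-scaleT : ∀ φ r T → extend φ (scaleT r T) ≈ r * extend φ T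
    extend-scaleT φ r T = begin
      extend φ (scaleT r T)                     ≡⟨ ∑-map T _ _ ⟩
      ∑[ t ← T ] (r * proj₁ t) * φ (proj₂ t)    ≈⟨ ∑-cong T (λ t → *-assoc _ _ _) ⟩
      ∑[ t ← T ] r * (proj₁ t * φ (proj₂ t))    ≈⟨ *-distribˡ-∑ r T _ ⟨
      r * extend φ T                            ∎

    extend-∪T-pure : ∀ φ T b → extend φ (T ∪T pure b) ≈ extend (λ a → φ (a ∪ᵥ b)) T
    extend-∪T-pure φ T b = trans (∑-concatMap T _ _)
      (∑-cong T (λ t → trans (+-identityʳ _) (*-congʳ (*-identityʳ _))))

    extend-symUnion-pure : ∀ invm φ T b →
      extend φ (symUnion invm T (pure b)) ≈ invm * (∑[ τ ← perms m ] extend (λ a → φ (a ∪ᵥ permute τ b)) T)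
    extend-symUnion-pure invm φ T b = begin
      extend φ (symUnion invm T (pure b))             ≈⟨ extend-scaleT φ invm (concatMap T∪τb (perms m)) ⟩
      invm * extend φ (concatMap T∪τb (perms m))      ≈⟨ *-congˡ (∑-concatMap (perms m) T∪τb _) ⟩
      invm * (∑[ τ ← perms m ] extend φ (T∪τb τ))
        ≈⟨ *-congˡ (∑-cong (perms m) (λ τ → extend-∪T-pure φ T (permute τ b))) ⟩
      invm * (∑[ τ ← perms m ] extend (λ a → φ (a ∪ᵥ permute τ b)) T) ∎
      where
      T∪τb : Perm m → Tensor k m
      T∪τb τ = T ∪T actT τ (pure b)

    extend-iterated-symUnion : ∀ invm {n} (bs : Fin n → Vec (Subset k) m) φ T →
      extend φ (foldl (symUnion invm) T (List.tabulate (pure ∘ bs))) ≈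
      powR invm n * (∑[ σ ← vecsOver (perms m) n ] extend (λ a → φ (a ∪ᵥ unionAlong σ bs)) T)
    extend-iterated-symUnion invm {zero} bs φ T = begin
      extend φ T                                                ≈⟨ extend-cong T (λ a → reflexive (P.cong φ (∪ᵥ-identityʳ a))) ⟨
      extend (λ a → φ (a ∪ᵥ replicate m ⊥)) T                   ≈⟨ +-identityʳ _ ⟨
      extend (λ a → φ (a ∪ᵥ replicate m ⊥)) T + 0#              ≈⟨ *-identityˡ _ ⟨
      1# * (extend (λ a → φ (a ∪ᵥ replicate m ⊥)) T + 0#)       ∎
    extend-iterated-symUnion invm {suc n} bs φ T = begin
      extend φ (foldl (symUnion invm) (symUnion invm T (pure (bs zero))) (List.tabulate (pure ∘ bs ∘ suc)))
        ≈⟨ extend-iterated-symUnion invm (bs ∘ suc) φ _ ⟩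
      powR invm n * (∑[ σ ← V ] extend (λ a → φ (a ∪ᵥ unionAlong σ (bs ∘ suc))) (symUnion invm T (pure (bs zero))))
        ≈⟨ *-congˡ (∑-cong V (λ σ → extend-symUnion-pure invm _ T (bs zero))) ⟩
      powR invm n * (∑[ σ ← V ] invm *
        (∑[ τ ← perms m ] extend (λ a → φ ((a ∪ᵥ permute τ (bs zero)) ∪ᵥ unionAlong σ (bs ∘ suc))) T))
        ≈⟨ *-congˡ (∑-cong V (λ σ → *-congˡ (∑-cong (perms m) (λ τ →
             extend-cong T (λ a → reflexive (P.cong φ (∪ᵥ-assoc _ _ _))))))) ⟩
      powR invm n * (∑[ σ ← V ] invm * (∑[ τ ← perms m ] E (τ ∷ σ)))
        ≈⟨ *-congˡ (*-distribˡ-∑ invm V _) ⟨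
      powR invm n * (invm * (∑[ σ ← V ] ∑[ τ ← perms m ] E (τ ∷ σ)))
        ≈⟨ x∙yz≈yx∙z _ _ _ ⟩
      powR invm (suc n) * (∑[ σ ← V ] ∑[ τ ← perms m ] E (τ ∷ σ))
        ≈⟨ *-congˡ (∑-comm V (perms m) _) ⟩
      powR invm (suc n) * (∑[ τ ← perms m ] ∑[ σ ← V ] E (τ ∷ σ))
        ≈⟨ *-congˡ (∑-vecsOver-suc (perms m) n E) ⟨
      powR invm (suc n) * (∑[ σ ← vecsOver (perms m) (suc n) ] E σ) ∎
      where
      V = vecsOver (perms m) n
      E : Vec (Perm m) (suc n) → Carrier
      E σ = extend (λ a → φ (a ∪ᵥ unionAlong σ bs)) T

  rhsSummand : ∀ {k m n} → (Subset k → Carrier) → ℕ → (Fin n → Vec (Subset k) m) → Vec (Perm m) n → Carrier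
  rhsSummand {m = m} {n} μ l a σ =
    ∑[ t ← monoSeqs m l ] ∑[ f ← nonemptyMaps n l ] ∏[ j ← allFin l ]
      sign (suc ∣ lookup f j ∣) * μ (⋂ (map (λ i → lookup (a i) (lookup (lookup σ i) (lookup t j))) (elements (lookup f j))))

  hPoly-unionAlong : ∀ {k m n} {μ : Subset k → Carrier} → IsMeasure μ → ∀ l (a : Fin n → Vec (Subset k) m) σ →
                     hPoly l (Vec.map μ (unionAlong σ a)) ≈ rhsSummand μ l a σ
  hPoly-unionAlong {m = m} {n} {μ} μ-measure l a σ = ∑-cong (monoSeqs m l) λ t →
    trans (∏-cong (allFin l) (λ j → μ-component (lookup t j)))
          (∏-∑-distrib (filter nonempty? (allSubsets n)) l (λ j S → sign (suc ∣ S ∣) * μ (⋂ (map (b (lookup t j)) (elements S)))))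
    where
    b : Fin m → Fin n → Subset _
    b r i = lookup (a i) (lookup (lookup σ i) r)
    μ-component : ∀ r → lookup (Vec.map μ (unionAlong σ a)) r ≈
                  ∑[ S ← filter nonempty? (allSubsets n) ]
                    sign (suc ∣ S ∣) * μ (⋂ (map (b r) (elements S)))
    μ-component r = trans (reflexive (P.trans (VP.lookup-map r μ (unionAlong σ a)) (P.cong μ (lookup-unionAlong σ a r))))
                          (inclusion-exclusion μ-measure (b r))

theorem4p9 : ∀ {c ℓ} (R : CommutativeRing c ℓ) →
  let open CommutativeRing R
      open WithRing R
  in (k m n l : ℕ) → 1 ≤ k → 1 ≤ m → 1 ≤ n → 1 ≤ l →
     (invm : Carrier) → invm * natR (m !) ≈ 1# →
     (μ : Subset k → Carrier) → IsMeasure μ →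
     (a : Fin n → Vec (Subset k) m) →
     hSym μ l (iterUnion invm (map (λ i → pure (a i)) (allFin n)))
       ≈ powR invm (n ∸ 1) * rhsSum μ l a
theorem4p9 R k m (suc n) l _ _ (s≤s _) _ invm _ μ μ-measure a = begin
  hSym μ l (iterUnion invm (map (λ i → pure (a i)) (allFin (suc n))))
    ≡⟨ P.cong (hSym μ l ∘ foldl (symUnion invm) (pure (a zero))) (LP.map-tabulate suc (pure ∘ a)) ⟩
  extend φ (foldl (symUnion invm) (pure (a zero)) (List.tabulate (pure ∘ a ∘ suc)))
    ≈⟨ extend-iterated-symUnion invm (a ∘ suc) φ (pure (a zero)) ⟩
  powR invm n * (∑[ σ ← V ] extend (λ v → φ (v ∪ᵥ unionAlong σ (a ∘ suc))) (pure (a zero)))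
    ≈⟨ *-congˡ (∑-cong V (λ σ → trans (extend-pure (λ v → φ (v ∪ᵥ unionAlong σ (a ∘ suc))) (a zero))
                                      (reflexive (P.cong φ (unionAlong-id σ a))))) ⟩
  powR invm n * (∑[ σ ← V ] φ (unionAlong (idPerm m ∷ σ) a))
    ≈⟨ *-congˡ (∑-cong V (λ σ → hPoly-unionAlong μ-measure l a (idPerm m ∷ σ))) ⟩
  powR invm n * (∑[ σ ← V ] rhsSummand μ l a (idPerm m ∷ σ))
    ≈⟨ *-congˡ (∑-permTuples (rhsSummand μ l a)) ⟨
  powR invm n * rhsSum μ l a ∎
  where
  open CommutativeRing R hiding (zero)
  open WithRing R
  open OverRing R
  open import Relation.Binary.Reasoning.Setoid setoid
  V = vecsOver (perms m) n
  φ : Vec (Subset k) m → Carrier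
  φ = hPoly l ∘ Vec.map μ
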